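{- Let $S$ be an LA-semigroup, $\gamma,\delta\in[0,1]$ with $\gamma<\delta$, and $\mu$ a fuzzy subset of $S$. Then: (i) $\mu$ is an $(\in_\gamma,\in_\gamma\vee q_\delta)$-fuzzy LA-subsemigroup of $S$ if and only if $\mu_r^\gamma$ is an LA-subsemigroup of $S$ for all $r\in(\gamma,\delta]$ with $\mu_r^\gamma\neq\emptyset$. (ii) If $2\delta=1+\gamma$, then $\mu$ is an $(\in_\gamma,\in_\gamma\vee q_\delta)$-fuzzy LA-subsemigroup of $S$ if and only if $\mu_r^\delta$ is an LA-subsemigroup of $S$ for all $r\in(\delta,1]$ with $\mu_r^\delta\neq\emptyset$. (iii) If $2\delta=1+\gamma$, then $\mu$ is an $(\in_\gamma,\in_\gamma\vee q_\delta)$-fuzzy LA-subsemigroup of $S$ if and only if $[\mu]_r^\delta$ is an LA-subsemigroup of $S$ for all $r\in(\gamma,1]$ with $[\mu]_r^\delta\neq\emptyset$. (iv) $\mu$ is an $(\in_\gamma,\in_\gamma\vee q_\delta)$-fuzzy LA-subsemigroup of $S$ if and only if $U(\mu;r)$ is an LA-subsemigroup of $S$ for all $r\in(\gamma,\delta]$ with $U(\mu;r)\neq\emptyset$.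
   Context: An LA-semigroup is a non-empty set $S$ with a binary operation (juxtaposition) satisfying $(xy)z=(zy)x$ for all $x,y,z\in S$. An LA-subsemigroup is a non-empty subset $A$ with $AA\subseteq A$. A fuzzy subset is a map $\mu:S\to[0,1]$. For $x\in S$, $t\in(0,1]$, $x_t$ is the fuzzy point with support $x$ and value $t$. $x_t\in_\gamma\mu$ means $\mu(x)\geq t>\gamma$; $x_t q_\delta\mu$ means $\mu(x)+t>2\delta$; $x_t\in_\gamma\vee q_\delta\mu$ means $x_t\in_\gamma\mu$ or $x_t q_\delta\mu$. $\mu$ is an $(\in_\gamma,\in_\gamma\vee q_\delta)$-fuzzy LA-subsemigroup if for all $a,b\in S$ and $t,r\in(\gamma,1]$, $a_t\in_\gamma\mu$ and $b_r\in_\gamma\mu$ imply $(ab)_{t\wedge r}\in_\gamma\vee q_\delta\mu$. Level sets: $\mu_r^\gamma=\{x\in S: x_r\in_\gamma\mu\}$, $\mu_r^\delta=\{x\in S: x_r q_\delta\mu\}$, $[\mu]_r^\delta=\{x\in S: x_r\in_\gamma\vee q_\delta\mu\}$, $U(\mu;r)=\{x\in S:\mu(x)\geq r\}$. -}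

module Defs where

open import Data.Product using (Σ; ∃; _×_; _,_)
open import Data.Sum using (_⊎_)
open import Relation.Nullary using (¬_)
open import Relation.Binary.PropositionalEquality using (_≡_)
open import Relation.Binary.Core using (Rel)
open import Relation.Binary.Definitions using (tri<; tri≈; tri>)
open import Relation.Binary.Structures using (IsStrictTotalOrder)
open import Algebra.Structures using (IsCommutativeRing)
open import Function.Bundles using (_⇔_)

-- The value domain.  The agda-stdlib has no real numbers, so fuzzy
-- subsets take values in the unit interval [0,1] of an ARBITRARY ordered
-- field F (the reals being one instance).

record OrderedField : Set₁ where
  field
    Carrier : Set
    _+_ _*_ : Carrier → Carrier → Carrier
    -_      : Carrier → Carrier
    0# 1#   : Carrier
    isCommutativeRing : IsCommutativeRing _≡_ _+_ _*_ -_ 0# 1#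
    _<_     : Rel Carrier _
    isStrictTotalOrder : IsStrictTotalOrder _≡_ _<_
    +-mono-< : ∀ {x y} z → x < y → (x + z) < (y + z)
    *-pos    : ∀ {x y} → 0# < x → 0# < y → 0# < (x * y)
    0<1      : 0# < 1#
    inverse  : ∀ x → ¬ (x ≡ 0#) → ∃ λ y → (x * y) ≡ 1#

  infixl 6 _+_
  infixl 7 _*_
  infix 4 _<_ _≤_

  _≤_ : Carrier → Carrier → Set
  x ≤ y = (x < y) ⊎ (x ≡ y)

  _⊓_ : Carrier → Carrier → Carrier
  x ⊓ y with IsStrictTotalOrder.compare isStrictTotalOrder x y
  ... | tri< _ _ _ = x
  ... | tri≈ _ _ _ = x
  ... | tri> _ _ _ = y

record LASemigroup : Set₁ where
  field
    Carrier : Set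
    _·_     : Carrier → Carrier → Carrier
    left-invertive : ∀ x y z → ((x · y) · z) ≡ ((z · y) · x)

module _ (S : LASemigroup) where
  open LASemigroup S

  Nonempty : (Carrier → Set) → Set
  Nonempty A = ∃ λ x → A x

  IsLASubsemigroup : (Carrier → Set) → Set
  IsLASubsemigroup A = Nonempty A × (∀ a b → A a → A b → A (a · b))

module Fuzzy (F : OrderedField) (S : LASemigroup) where
  open OrderedField F renaming (Carrier to I)
  open LASemigroup S renaming (Carrier to X)

  IsFuzzySubset : (X → I) → Set
  IsFuzzySubset μ = ∀ x → (0# ≤ μ x) × (μ x ≤ 1#)

  module _ (γ δ : I) (μ : X → I) where
    _∈[_]γ : X → I → Set
    x ∈[ t ]γ = (t ≤ μ x) × (γ < t)

    _q[_]δ : X → I → Set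
    x q[ t ]δ = (δ + δ) < (μ x + t)

    _∈∨q[_] : X → I → Set
    x ∈∨q[ t ] = (x ∈[ t ]γ) ⊎ (x q[ t ]δ)

    IsFuzzyLASub : Set
    IsFuzzyLASub = ∀ a b t r → γ < t → t ≤ 1# → γ < r → r ≤ 1# →
                   a ∈[ t ]γ → b ∈[ r ]γ → (a · b) ∈∨q[ t ⊓ r ]

    level-γ : I → X → Set
    level-γ r x = x ∈[ r ]γ

    level-δ : I → X → Set
    level-δ r x = x q[ r ]δ

    level-∨ : I → X → Set
    level-∨ r x = x ∈∨q[ r ]

    U : I → X → Set
    U r x = r ≤ μ x

  LevelCondition : (lo hi : I) → (I → X → Set) → Set
  LevelCondition lo hi A =
    ∀ r → lo < r → r ≤ hi → Nonempty S (A r) → IsLASubsemigroup S (A r)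

-- All four conditions are closedness, under the product, of upper level sets of μ.  The
-- (∈γ, ∈γ ∨ qδ) condition is equivalent to closedness of U(μ; r) for r ∈ (γ, δ]: when
-- t ∧ r ≤ δ the ∈γ disjunct is that closedness, and when t ∧ r > δ the qδ disjunct follows from
-- closedness at level δ.  If 2δ = 1 + γ, then μ_r^δ is the strict level set {μ > 2δ − r}, and
-- r ↦ 2δ − r maps (δ, 1] onto [γ, δ), on which closedness of strict and of non-strict levels are
-- equivalent.  Finally [μ]_r^δ is μ_r^γ for r ≤ δ and μ_r^δ for r > δ, so (iii) combines (i)
-- and (ii).
module Submission where

open import Defs
open import Data.Empty using (⊥-elim)
open import Data.Product using (_×_; _,_; proj₁; proj₂)
open import Data.Product.Function.NonDependent.Propositional using (_×-⇔_)
open import Data.Sum using (_⊎_; inj₁; inj₂; [_,_])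
open import Function using (id)
open import Function.Bundles using (_⇔_; mk⇔; Equivalence)
open import Function.Construct.Composition using () renaming (equivalence to ⇔-trans)
open import Function.Construct.Symmetry using (⇔-sym)
open import Relation.Binary.PropositionalEquality
  using (_≡_; refl; sym; trans; cong; subst; subst₂; isEquivalence; module ≡-Reasoning)
open import Relation.Binary.Definitions using (tri<; tri≈; tri>)
open import Relation.Binary.Structures using (IsStrictTotalOrder)
open import Relation.Nullary using (¬_)
open import Algebra.Bundles using (AbelianGroup)
open import Algebra.Structures using (IsCommutativeRing)
import Algebra.Properties.AbelianGroup as AbelianGroupProperties
import Relation.Binary.Construct.StrictToNonStrict as StrictToNonStrict

⇔-× : ∀ {P A B : Set} → P ⇔ A → P ⇔ B → P ⇔ (A × B)
⇔-× P⇔A P⇔B = mk⇔ (λ p → Equivalence.to P⇔A p , Equivalence.to P⇔B p)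
                  (λ (a , _) → Equivalence.from P⇔A a)

module OrderedFieldProperties (F : OrderedField) where
  open OrderedField F
  open IsCommutativeRing isCommutativeRing using (+-comm; +-assoc; +-isAbelianGroup)
  open IsStrictTotalOrder isStrictTotalOrder
    using (compare; irrefl; asym; <-resp-≈; <-respʳ-≈; <-respˡ-≈)
    renaming (trans to <-trans)

  +-abelianGroup : AbelianGroup _ _
  +-abelianGroup = record { isAbelianGroup = +-isAbelianGroup }

  open AbelianGroupProperties +-abelianGroup
    using (//-rightDividesˡ; //-rightDividesʳ; ⁻¹-anti-homo-//; xyx⁻¹≈y)

  infixl 6 _-_
  _-_ : Carrier → Carrier → Carrier
  x - y = x + - y

  private variable x y z u v : Carrier

  <-irrefl : ¬ x < x
  <-irrefl = irrefl refl

  <-asym : x < y → ¬ y < x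
  <-asym = asym

  ≤-refl : x ≤ x
  ≤-refl = StrictToNonStrict.reflexive _≡_ _<_ refl

  ≤-trans : x ≤ y → y ≤ z → x ≤ z
  ≤-trans = StrictToNonStrict.trans _≡_ _<_ isEquivalence <-resp-≈ <-trans

  <-≤-trans : x < y → y ≤ z → x < z
  <-≤-trans = StrictToNonStrict.<-≤-trans _≡_ _<_ <-trans <-respʳ-≈

  ≤-<-trans : x ≤ y → y < z → x < z
  ≤-<-trans = StrictToNonStrict.≤-<-trans _≡_ _<_ sym <-trans <-respˡ-≈

  ≤⊎> : ∀ x y → x ≤ y ⊎ y < x
  ≤⊎> x y with compare x y
  ... | tri< x<y _ _ = inj₁ (inj₁ x<y)
  ... | tri≈ _ x≡y _ = inj₁ (inj₂ x≡y)
  ... | tri> _ _ y<x = inj₂ y<x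

  +-monoˡ-< : x < y → x + z < y + z
  +-monoˡ-< {z = z} = +-mono-< z

  +-monoʳ-< : x < y → z + x < z + y
  +-monoʳ-< {x} {y} {z} x<y = subst₂ _<_ (+-comm x z) (+-comm y z) (+-monoˡ-< x<y)

  +-monoˡ-≤ : x ≤ y → x + z ≤ y + z
  +-monoˡ-≤ (inj₁ x<y) = inj₁ (+-monoˡ-< x<y)
  +-monoˡ-≤ (inj₂ refl) = ≤-refl

  +-monoʳ-≤ : x ≤ y → z + x ≤ z + y
  +-monoʳ-≤ (inj₁ x<y) = inj₁ (+-monoʳ-< x<y)
  +-monoʳ-≤ (inj₂ refl) = ≤-refl

  +-mono-≤ : x ≤ y → u ≤ v → x + u ≤ y + v
  +-mono-≤ x≤y u≤v = ≤-trans (+-monoˡ-≤ x≤y) (+-monoʳ-≤ u≤v)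

  +-mono-<-≤ : x < y → u ≤ v → x + u < y + v
  +-mono-<-≤ x<y u≤v = <-≤-trans (+-monoˡ-< x<y) (+-monoʳ-≤ u≤v)

  +-mono-≤-< : x ≤ y → u < v → x + u < y + v
  +-mono-≤-< x≤y u<v = ≤-<-trans (+-monoˡ-≤ x≤y) (+-monoʳ-< u<v)

  x-z<y⇒x<y+z : x - z < y → x < y + z
  x-z<y⇒x<y+z {x} {z} {y} p = subst (_< y + z) (//-rightDividesˡ z x) (+-monoˡ-< p)

  x<y+z⇒x-z<y : x < y + z → x - z < y
  x<y+z⇒x-z<y {x} {y} {z} p = subst (x - z <_) (//-rightDividesʳ z y) (+-monoˡ-< p)

  x+z<y⇒x<y-z : x + z < y → x < y - z
  x+z<y⇒x<y-z {x} {z} {y} p = subst (_< y - z) (//-rightDividesʳ z x) (+-monoˡ-< p)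

  x≤y+z⇒x-z≤y : x ≤ y + z → x - z ≤ y
  x≤y+z⇒x-z≤y {x} {y} {z} p = subst (x - z ≤_) (//-rightDividesʳ z y) (+-monoˡ-≤ p)

  x+z≤y⇒x≤y-z : x + z ≤ y → x ≤ y - z
  x+z≤y⇒x≤y-z {x} {z} {y} p = subst (_≤ y - z) (//-rightDividesʳ z x) (+-monoˡ-≤ p)

  x-[x-y]≡y : ∀ x y → x - (x - y) ≡ y
  x-[x-y]≡y x y = begin
    x + - (x - y)  ≡⟨ cong (x +_) (⁻¹-anti-homo-// x y) ⟩
    x + (y - x)    ≡⟨ sym (+-assoc x y (- x)) ⟩
    x + y - x      ≡⟨ xyx⁻¹≈y x y ⟩
    y              ∎
    where open ≡-Reasoning

  ⊓-preserves : (P : Carrier → Set) → P x → P y → P (x ⊓ y)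
  ⊓-preserves {x} {y} P px py with compare x y
  ... | tri< _ _ _ = px
  ... | tri≈ _ _ _ = px
  ... | tri> _ _ _ = py

  x⊓y≤x : x ⊓ y ≤ x
  x⊓y≤x {x} {y} with compare x y
  ... | tri< _ _ _ = ≤-refl
  ... | tri≈ _ _ _ = ≤-refl
  ... | tri> _ _ y<x = inj₁ y<x

  x⊓y≤y : x ⊓ y ≤ y
  x⊓y≤y {x} {y} with compare x y
  ... | tri< x<y _ _ = inj₁ x<y
  ... | tri≈ _ x≡y _ = inj₂ x≡y
  ... | tri> _ _ _ = ≤-refl

module LevelSets (F : OrderedField) (S : LASemigroup) where
  open OrderedField F renaming (Carrier to I)
  open LASemigroup S renaming (Carrier to X)
  open OrderedFieldProperties F

  Closed : (X → Set) → Set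
  Closed A = ∀ a b → A a → A b → A (a · b)

  ClosedOn : (lo hi : I) → (I → X → Set) → Set
  ClosedOn lo hi A = ∀ r → lo < r → r ≤ hi → Closed (A r)

  UpperLevel : (X → I) → I → X → Set
  UpperLevel μ r x = r ≤ μ x

  StrictUpperLevel : (X → I) → I → X → Set
  StrictUpperLevel μ s x = s < μ x

  StrictUpperLevelsClosedOn : (lo hi : I) → (X → I) → Set
  StrictUpperLevelsClosedOn lo hi μ = ∀ s → lo ≤ s → s < hi → Closed (StrictUpperLevel μ s)

  levelCondition⇔closedOn : ∀ {lo hi A} → Fuzzy.LevelCondition F S lo hi A ⇔ ClosedOn lo hi A
  levelCondition⇔closedOn = mk⇔
    (λ L r lo<r r≤hi a b Aa Ab → proj₂ (L r lo<r r≤hi (a , Aa)) a b Aa Ab)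
    (λ C r lo<r r≤hi nonempty → nonempty , C r lo<r r≤hi)

  closed-resp-⇔ : ∀ {A B} → (∀ x → A x ⇔ B x) → Closed A → Closed B
  closed-resp-⇔ A⇔B C a b Ba Bb = to (A⇔B _) (C a b (from (A⇔B a) Ba) (from (A⇔B b) Bb))
    where open Equivalence using (to; from)

  closedOn-cong : ∀ {lo hi A B} → (∀ r → lo < r → r ≤ hi → ∀ x → A r x ⇔ B r x) →
                  ClosedOn lo hi A ⇔ ClosedOn lo hi B
  closedOn-cong A⇔B = mk⇔
    (λ C r lo<r r≤hi → closed-resp-⇔ (A⇔B r lo<r r≤hi) (C r lo<r r≤hi))
    (λ C r lo<r r≤hi → closed-resp-⇔ (λ x → ⇔-sym (A⇔B r lo<r r≤hi x)) (C r lo<r r≤hi))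

  closedOn-split : ∀ {lo mid hi A} → lo ≤ mid → mid ≤ hi →
                   ClosedOn lo hi A ⇔ (ClosedOn lo mid A × ClosedOn mid hi A)
  closedOn-split {mid = mid} lo≤mid mid≤hi = mk⇔
    (λ C → (λ r lo<r r≤mid → C r lo<r (≤-trans r≤mid mid≤hi))
         , (λ r mid<r r≤hi → C r (≤-<-trans lo≤mid mid<r) r≤hi))
    (λ (C₁ , C₂) r lo<r r≤hi → [ C₁ r lo<r , (λ mid<r → C₂ r mid<r r≤hi) ] (≤⊎> r mid))

  -- For an upper level set that is not closed, the level μ(ab) itself (or lo, if that is
  -- higher) indexes a strict level set that is not closed either.
  upperLevelsClosed⇔strictUpperLevelsClosed : ∀ {lo hi} (μ : X → I) →
    ClosedOn lo hi (UpperLevel μ) ⇔ StrictUpperLevelsClosedOn lo hi μ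
  upperLevelsClosed⇔strictUpperLevelsClosed {lo} {hi} μ = mk⇔ strict nonStrict
    where
    strict : ClosedOn lo hi (UpperLevel μ) → StrictUpperLevelsClosedOn lo hi μ
    strict C s lo≤s s<hi a b s<μa s<μb = <-≤-trans s<m (C m lo<m m≤hi a b m≤μa m≤μb)
      where
      m : I
      m = (μ a ⊓ μ b) ⊓ hi
      s<m : s < m
      s<m = ⊓-preserves (s <_) (⊓-preserves (s <_) s<μa s<μb) s<hi
      lo<m : lo < m
      lo<m = ≤-<-trans lo≤s s<m
      m≤hi : m ≤ hi
      m≤hi = x⊓y≤y
      m≤μa : m ≤ μ a
      m≤μa = ≤-trans x⊓y≤x x⊓y≤x
      m≤μb : m ≤ μ b
      m≤μb = ≤-trans x⊓y≤x x⊓y≤y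

    nonStrict : StrictUpperLevelsClosedOn lo hi μ → ClosedOn lo hi (UpperLevel μ)
    nonStrict C r lo<r r≤hi a b r≤μa r≤μb with ≤⊎> r (μ (a · b))
    ... | inj₁ r≤μab = r≤μab
    ... | inj₂ μab<r with ≤⊎> lo (μ (a · b))
    ...   | inj₁ lo≤μab = ⊥-elim (<-irrefl (C (μ (a · b)) lo≤μab (<-≤-trans μab<r r≤hi) a b
                                             (<-≤-trans μab<r r≤μa) (<-≤-trans μab<r r≤μb)))
    ...   | inj₂ μab<lo = ⊥-elim (<-asym μab<lo (C lo ≤-refl (<-≤-trans lo<r r≤hi) a b
                                             (<-≤-trans lo<r r≤μa) (<-≤-trans lo<r r≤μb)))

module FuzzyLASubsemigroups (F : OrderedField) (S : LASemigroup) where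
  open OrderedField F renaming (Carrier to I)
  open LASemigroup S renaming (Carrier to X)
  open OrderedFieldProperties F
  open IsCommutativeRing isCommutativeRing using (+-comm)
  open LevelSets F S
  open Fuzzy F S

  module _ (γ δ : I) (μ : X → I) where

    qLevel⊆upperLevel : ∀ {r x} → r ≤ δ → level-δ γ δ μ r x → r ≤ μ x
    qLevel⊆upperLevel {r} {x} r≤δ q with ≤⊎> r (μ x)
    ... | inj₁ r≤μx = r≤μx
    ... | inj₂ μx<r = ⊥-elim (<-asym q (<-≤-trans (+-monoˡ-< μx<r) (+-mono-≤ r≤δ r≤δ)))

    upperLevel⊆qLevel : ∀ {r x} → δ < r → r ≤ μ x → level-δ γ δ μ r x
    upperLevel⊆qLevel δ<r r≤μx = +-mono-<-≤ (<-≤-trans δ<r r≤μx) (inj₁ δ<r)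

    isFuzzyLASub⇔upperLevelsClosed : δ ≤ 1# → γ < δ →
      IsFuzzyLASub γ δ μ ⇔ ClosedOn γ δ (UpperLevel μ)
    isFuzzyLASub⇔upperLevelsClosed δ≤1 γ<δ = mk⇔ closed fuzzy
      where
      closed : IsFuzzyLASub γ δ μ → ClosedOn γ δ (UpperLevel μ)
      closed H r γ<r r≤δ a b r≤μa r≤μb
        with H a b r r γ<r (≤-trans r≤δ δ≤1) γ<r (≤-trans r≤δ δ≤1) (r≤μa , γ<r) (r≤μb , γ<r)
      ... | inj₁ (r⊓r≤μab , _) = ≤-trans (⊓-preserves (r ≤_) ≤-refl ≤-refl) r⊓r≤μab
      ... | inj₂ q = qLevel⊆upperLevel r≤δ (<-≤-trans q (+-monoʳ-≤ x⊓y≤x))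

      fuzzy : ClosedOn γ δ (UpperLevel μ) → IsFuzzyLASub γ δ μ
      fuzzy C a b t r γ<t _ γ<r _ (t≤μa , _) (r≤μb , _) with ≤⊎> (t ⊓ r) δ
      ... | inj₁ m≤δ = inj₁ (C (t ⊓ r) γ<m m≤δ a b m≤μa m≤μb , γ<m)
        where
        γ<m : γ < t ⊓ r
        γ<m = ⊓-preserves (γ <_) γ<t γ<r
        m≤μa : t ⊓ r ≤ μ a
        m≤μa = ≤-trans x⊓y≤x t≤μa
        m≤μb : t ⊓ r ≤ μ b
        m≤μb = ≤-trans x⊓y≤y r≤μb
      ... | inj₂ δ<m = inj₂ (+-mono-≤-< (C δ γ<δ ≤-refl a b δ≤μa δ≤μb) δ<m)
        where
        δ≤μa : δ ≤ μ a
        δ≤μa = inj₁ (<-≤-trans δ<m (≤-trans x⊓y≤x t≤μa))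
        δ≤μb : δ ≤ μ b
        δ≤μb = inj₁ (<-≤-trans δ<m (≤-trans x⊓y≤y r≤μb))

    level-γ-closed⇔upperLevelsClosed : ∀ {hi} →
      ClosedOn γ hi (level-γ γ δ μ) ⇔ ClosedOn γ hi (UpperLevel μ)
    level-γ-closed⇔upperLevelsClosed = closedOn-cong λ _ γ<r _ _ → mk⇔ proj₁ (_, γ<r)

    level-∨-closed⇔level-γ-closed×level-δ-closed : δ ≤ 1# → γ < δ →
      ClosedOn γ 1# (level-∨ γ δ μ) ⇔
      (ClosedOn γ δ (level-γ γ δ μ) × ClosedOn δ 1# (level-δ γ δ μ))
    level-∨-closed⇔level-γ-closed×level-δ-closed δ≤1 γ<δ =
      ⇔-trans (closedOn-split (inj₁ γ<δ) δ≤1) (closedOn-cong below ×-⇔ closedOn-cong above)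
      where
      below : ∀ r → γ < r → r ≤ δ → ∀ x → level-∨ γ δ μ r x ⇔ level-γ γ δ μ r x
      below r γ<r r≤δ x = mk⇔ [ id , (λ q → qLevel⊆upperLevel r≤δ q , γ<r) ] inj₁

      above : ∀ r → δ < r → r ≤ 1# → ∀ x → level-∨ γ δ μ r x ⇔ level-δ γ δ μ r x
      above r δ<r _ x = mk⇔ [ (λ (r≤μx , _) → upperLevel⊆qLevel δ<r r≤μx) , id ] inj₂

    level-δ-closed⇔strictUpperLevelsClosed : δ + δ ≡ 1# + γ →
      ClosedOn δ 1# (level-δ γ δ μ) ⇔ StrictUpperLevelsClosedOn γ δ μ
    level-δ-closed⇔strictUpperLevelsClosed 2δ≡1+γ = mk⇔ toStrict fromStrict
      where
      toStrict : ClosedOn δ 1# (level-δ γ δ μ) → StrictUpperLevelsClosedOn γ δ μ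
      toStrict C s γ≤s s<δ = closed-resp-⇔ level-δ⇔strict (C (δ + δ - s) δ<r r≤1)
        where
        δ<r : δ < δ + δ - s
        δ<r = x+z<y⇒x<y-z (+-monoʳ-< s<δ)
        r≤1 : δ + δ - s ≤ 1#
        r≤1 = x≤y+z⇒x-z≤y (subst (_≤ 1# + s) (sym 2δ≡1+γ) (+-monoʳ-≤ γ≤s))
        level-δ⇔strict : ∀ x → level-δ γ δ μ (δ + δ - s) x ⇔ StrictUpperLevel μ s x
        level-δ⇔strict x = mk⇔
          (λ q → subst (_< μ x) (x-[x-y]≡y (δ + δ) s) (x<y+z⇒x-z<y q))
          (λ s<μx → x-z<y⇒x<y+z (subst (_< μ x) (sym (x-[x-y]≡y (δ + δ) s)) s<μx))

      fromStrict : StrictUpperLevelsClosedOn γ δ μ → ClosedOn δ 1# (level-δ γ δ μ)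
      fromStrict C r δ<r r≤1 = closed-resp-⇔ strict⇔level-δ (C (δ + δ - r) γ≤s s<δ)
        where
        γ≤s : γ ≤ δ + δ - r
        γ≤s = x+z≤y⇒x≤y-z (subst (γ + r ≤_) (trans (+-comm γ 1#) (sym 2δ≡1+γ)) (+-monoʳ-≤ r≤1))
        s<δ : δ + δ - r < δ
        s<δ = x<y+z⇒x-z<y (+-monoʳ-< δ<r)
        strict⇔level-δ : ∀ x → StrictUpperLevel μ (δ + δ - r) x ⇔ level-δ γ δ μ r x
        strict⇔level-δ x = mk⇔ x-z<y⇒x<y+z x<y+z⇒x-z<y

mainTheorem4 : (F : OrderedField) (S : LASemigroup) →
    let open OrderedField F
        open Fuzzy F S
    in (γ δ : Carrier) → 0# ≤ γ → γ ≤ 1# → 0# ≤ δ → δ ≤ 1# → γ < δ →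
       (μ : LASemigroup.Carrier S → Carrier) → IsFuzzySubset μ →
       (IsFuzzyLASub γ δ μ ⇔ LevelCondition γ δ (level-γ γ δ μ))
       × ((δ + δ) ≡ (1# + γ) →
            IsFuzzyLASub γ δ μ ⇔ LevelCondition δ 1# (level-δ γ δ μ))
       × ((δ + δ) ≡ (1# + γ) →
            IsFuzzyLASub γ δ μ ⇔ LevelCondition γ 1# (level-∨ γ δ μ))
       × (IsFuzzyLASub γ δ μ ⇔ LevelCondition γ δ (U γ δ μ))
mainTheorem4 F S γ δ _ _ _ δ≤1 γ<δ μ _ =
  viaLevelCondition fuzzy⇔level-γ ,
  (λ e → viaLevelCondition (fuzzy⇔level-δ e)) ,
  (λ e → viaLevelCondition (⇔-trans (⇔-× fuzzy⇔level-γ (fuzzy⇔level-δ e))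
                                    (⇔-sym (level-∨-closed⇔level-γ-closed×level-δ-closed
                                              γ δ μ δ≤1 γ<δ)))) ,
  viaLevelCondition fuzzy⇔upper
  where
  open OrderedField F
  open Fuzzy F S
  open LevelSets F S
  open FuzzyLASubsemigroups F S

  viaLevelCondition : ∀ {P lo hi A} → P ⇔ ClosedOn lo hi A → P ⇔ LevelCondition lo hi A
  viaLevelCondition P⇔C = ⇔-trans P⇔C (⇔-sym levelCondition⇔closedOn)

  fuzzy⇔upper : IsFuzzyLASub γ δ μ ⇔ ClosedOn γ δ (UpperLevel μ)
  fuzzy⇔upper = isFuzzyLASub⇔upperLevelsClosed γ δ μ δ≤1 γ<δ

  fuzzy⇔level-γ : IsFuzzyLASub γ δ μ ⇔ ClosedOn γ δ (level-γ γ δ μ)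
  fuzzy⇔level-γ = ⇔-trans fuzzy⇔upper (⇔-sym (level-γ-closed⇔upperLevelsClosed γ δ μ))

  fuzzy⇔level-δ : δ + δ ≡ 1# + γ → IsFuzzyLASub γ δ μ ⇔ ClosedOn δ 1# (level-δ γ δ μ)
  fuzzy⇔level-δ e =
    ⇔-trans fuzzy⇔upper (⇔-trans (upperLevelsClosed⇔strictUpperLevelsClosed μ)
                                 (⇔-sym (level-δ-closed⇔strictUpperLevelsClosed γ δ μ e)))
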